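{- For every non-negative integer $n$, $\ell_n$ is a prefix of $\ell_{n+1}$ and $m_n$ is a prefix of $m_{n+1}$.
   Context: For non-empty $X$, $X^-$ is $X$ with last letter erased; a $4^-$-power is $XXXX^-$ with $X$ non-empty; a binary word is faux-bonacci (fb) if it has no factor $11$ and no factor that is a $4^-$-power. Words are ordered lexicographically with $0<1$. For $n\ge0$, $\ell_n$ (resp. $m_n$) is the lexicographically least (resp. greatest) binary word of length $n$ that is a prefix of some fb $\omega$-word. -}

module Defs where

open import Data.Bool using (Bool; true; false)
open import Data.Nat using (ℕ; zero; suc; _+_)
open import Data.List using (List; []; _∷_; _++_; length)
open import Data.Product using (Σ; ∃; _×_; _,_)
open import Relation.Binary.PropositionalEquality using (_≡_; _≢_)
open import Relation.Nullary using (¬_)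

-- Binary words: lists of Bool, with false = 0 and true = 1.
Word : Set
Word = List Bool

-- X⁻ : X with its last letter erased (identity on the empty word, never used there).
erase-last : Word → Word
erase-last []           = []
erase-last (a ∷ [])     = []
erase-last (a ∷ b ∷ xs) = a ∷ erase-last (b ∷ xs)

Factor : Word → Word → Set
Factor f w = Σ Word λ u → Σ Word λ v → w ≡ u ++ f ++ v

Prefix : Word → Word → Set
Prefix p w = Σ Word λ v → p ++ v ≡ w

Is4⁻Power : Word → Set
Is4⁻Power w = Σ Word λ X → (X ≢ []) × (w ≡ X ++ X ++ X ++ erase-last X)

FB : Word → Set
FB w = ¬ Factor (true ∷ true ∷ []) w × ¬ (Σ Word λ f → Factor f w × Is4⁻Power f)

ωWord : Set
ωWord = ℕ → Bool

factorω : ωWord → ℕ → ℕ → Word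
factorω x i zero    = []
factorω x i (suc k) = x i ∷ factorω x (suc i) k

-- an ω-word is faux-bonacci iff it has no factor 11 and no 4⁻-power factor,
-- i.e. every finite factor of it is fb
FBω : ωWord → Set
FBω x = ∀ i k → FB (factorω x i k)

FBPrefix : Word → Set
FBPrefix w = Σ ωWord λ x → FBω x × factorω x 0 (length w) ≡ w

data _≤lex_ : Word → Word → Set where
  []≤    : ∀ {w} → [] ≤lex w
  0<1    : ∀ {u v} → (false ∷ u) ≤lex (true ∷ v)
  same   : ∀ {a u v} → u ≤lex v → (a ∷ u) ≤lex (a ∷ v)

IsLeastFB : ℕ → Word → Set
IsLeastFB n u = length u ≡ n × FBPrefix u ×
  (∀ w → length w ≡ n → FBPrefix w → u ≤lex w)

IsGreatestFB : ℕ → Word → Set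
IsGreatestFB n u = length u ≡ n × FBPrefix u ×
  (∀ w → length w ≡ n → FBPrefix w → w ≤lex u)

{-# OPTIONS --safe #-}
module Submission where

open import Defs
open import Data.Nat using (ℕ; zero; suc; _≤_)
open import Data.Nat.Properties using (n≤1+n; m≤n⇒m⊓n≡m; suc-injective)
open import Data.List using ([]; _∷_; _++_; length; take; drop)
open import Data.List.Properties using (∷-injective; ∷-injectiveʳ; length-take; take++drop≡id)
open import Data.Product using (Σ; _×_; _,_; proj₁)
open import Function using (flip)
open import Relation.Binary.Core using (Rel)
open import Relation.Binary.Definitions using (Antisymmetric)
open import Relation.Binary.PropositionalEquality

-- The least length-(n+1) word of a prefix-closed, extendable language cuts down to
-- an admissible length-n word, and the least length-n word extends to an admissible
-- length-(n+1) word; comparing the two forces the cut to be the least length-n word.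
-- Greatest words are least words for the reversed lexicographic order.

length-factorω : ∀ x i k → length (factorω x i k) ≡ k
length-factorω x i zero    = refl
length-factorω x i (suc k) = cong suc (length-factorω x (suc i) k)

factorω-prefix-suc : ∀ x i k → Prefix (factorω x i k) (factorω x i (suc k))
factorω-prefix-suc x i zero    = x i ∷ [] , refl
factorω-prefix-suc x i (suc k) with factorω-prefix-suc x (suc i) k
... | v , e = v , cong (x i ∷_) e

prefix-factorω : ∀ x i k u → Prefix u (factorω x i k) → factorω x i (length u) ≡ u
prefix-factorω x i k       []      _ = refl
prefix-factorω x i zero    (a ∷ u) (v , ())
prefix-factorω x i (suc k) (a ∷ u) (v , e) =
  cong₂ _∷_ (sym (proj₁ (∷-injective e))) (prefix-factorω x (suc i) k u (v , ∷-injectiveʳ e))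

PrefixClosed : (Word → Set) → Set
PrefixClosed P = ∀ {u w} → Prefix u w → P w → P u

Extendable : (Word → Set) → Set
Extendable P = ∀ {u} → P u → Σ Word λ w → length w ≡ suc (length u) × Prefix u w × P w

FBPrefix-closed : PrefixClosed FBPrefix
FBPrefix-closed {u} {w} (v , u++v≡w) (x , fb , x≡w) =
  x , fb , prefix-factorω x 0 (length w) u (v , trans u++v≡w (sym x≡w))

FBPrefix-extendable : Extendable FBPrefix
FBPrefix-extendable {u} (x , fb , x≡u) =
  factorω x 0 (suc n) ,
  length-factorω x 0 (suc n) ,
  subst (λ p → Prefix p (factorω x 0 (suc n))) x≡u
        (factorω-prefix-suc x 0 n) ,
  (x , fb , cong (factorω x 0) (length-factorω x 0 (suc n)))
  where n = length u

≤lex-antisym : Antisymmetric _≡_ _≤lex_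
≤lex-antisym []≤      []≤      = refl
≤lex-antisym 0<1      ()
≤lex-antisym (same p) (same q) = cong (_ ∷_) (≤lex-antisym p q)

≤lex-++ : ∀ u v {s t} → length u ≡ length v → (u ++ s) ≤lex (v ++ t) → u ≤lex v
≤lex-++ []      v       _   _        = []≤
≤lex-++ (a ∷ u) []      ()  _
≤lex-++ (a ∷ u) (b ∷ v) _   0<1      = 0<1
≤lex-++ (a ∷ u) (b ∷ v) |u| (same p) = same (≤lex-++ u v (suc-injective |u|) p)

CutsToPrefixes : Rel Word _ → Set
CutsToPrefixes R = ∀ u v {s t} → length u ≡ length v → R (u ++ s) (v ++ t) → R u v

Least : Rel Word _ → (Word → Set) → ℕ → Word → Set
Least R P n u = length u ≡ n × P u × (∀ w → length w ≡ n → P w → R u w)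

least-prefix-least : ∀ {R P} → Antisymmetric _≡_ R → CutsToPrefixes R →
  PrefixClosed P → Extendable P →
  ∀ {n u w} → Least R P n u → Least R P (suc n) w → Prefix u w
least-prefix-least {R} antisym cut closed extend {n} {u} {w}
                   (|u| , Pu , u-least) (|w| , Pw , w-least)
  with extend Pu
... | w′ , |w′| , (s , u++s≡w′) , Pw′ =
  drop n w , trans (cong (_++ drop n w) u≡p) (take++drop≡id n w)
  where
  p = take n w

  |p| : length p ≡ n
  |p| = trans (length-take n w) (m≤n⇒m⊓n≡m (subst (n ≤_) (sym |w|) (n≤1+n n)))

  R-u-p : R u p
  R-u-p = u-least p |p| (closed (drop n w , take++drop≡id n w) Pw)

  R-p-u : R p u
  R-p-u = cut p u (trans |p| (sym |u|))
    (subst₂ R (sym (take++drop≡id n w)) (sym u++s≡w′)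
      (w-least w′ (trans |w′| (cong suc |u|)) Pw′))

  u≡p : u ≡ p
  u≡p = antisym R-u-p R-p-u

lemma10 : ∀ (n : ℕ) →
    (∀ ℓn ℓn+1 → IsLeastFB n ℓn → IsLeastFB (suc n) ℓn+1 → Prefix ℓn ℓn+1) ×
    (∀ mn mn+1 → IsGreatestFB n mn → IsGreatestFB (suc n) mn+1 → Prefix mn mn+1)
lemma10 _ =
  (λ _ _ → least-prefix-least ≤lex-antisym ≤lex-++
             FBPrefix-closed FBPrefix-extendable) ,
  (λ _ _ → least-prefix-least (flip ≤lex-antisym)
             (λ u v |u| → ≤lex-++ v u (sym |u|))
             FBPrefix-closed FBPrefix-extendable)
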